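{- Let $k \geq 1$, let $X = \mathrm{diag}(x_1,\ldots,x_k)$ with complex $x_i$, let $z_1,\ldots,z_k$ be formal commuting variables and $Z = \mathrm{diag}(z_1,\ldots,z_k)$, and let $\delta_-(X)$ be the $k\times k$ matrix with $(i,j)$ entry $x_i-x_j$. Then \[ \det(xI - Z\,\delta_-(X)) = x^k + \left( \sum_{1 \leq i < j \leq k} z_i z_j (x_i - x_j)^2 \right) x^{k-2}. \] Consequently, for $k \geq 2$, its roots (in an algebraic closure) are $\pm i \sqrt{\sum_{i<j} z_i z_j (x_i - x_j)^2}$, each with multiplicity one, together with $0$ with multiplicity $k-2$. -}

module Defs where

open import Level using (Level)
open import Data.Nat using (ℕ; zero; suc)
open import Data.Fin using (Fin; zero; suc; punchIn; _≟_)
open import Relation.Nullary using (yes; no)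
open import Algebra.Bundles using (CommutativeRing)

module MatrixDefs {c ℓ : Level} (R : CommutativeRing c ℓ) where
  open CommutativeRing R hiding (zero)

  Matrix : ℕ → Set c
  Matrix n = Fin n → Fin n → Carrier

  sumF : ∀ {n} → (Fin n → Carrier) → Carrier
  sumF {zero}  f = 0#
  sumF {suc n} f = f zero + sumF (λ i → f (suc i))

  -- sum over pairs i < j in Fin n:  Σ_{i<j} f i j
  sumPairs : ∀ {n} → (Fin n → Fin n → Carrier) → Carrier
  sumPairs {zero}  f = 0#
  sumPairs {suc n} f = sumF (λ j → f zero (suc j)) + sumPairs (λ i j → f (suc i) (suc j))

  pow : Carrier → ℕ → Carrier
  pow x zero    = 1#
  pow x (suc n) = x * pow x n

  sgn : ∀ {n} → Fin n → Carrier
  sgn zero    = 1#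
  sgn (suc j) = - sgn j

  minor : ∀ {n} → Matrix (suc n) → Fin (suc n) → Matrix n
  minor M j r c = M (suc r) (punchIn j c)

  det : ∀ {n} → Matrix n → Carrier
  det {zero}  M = 1#
  det {suc n} M = sumF (λ j → sgn j * (M zero j * det (minor M j)))

  identity : ∀ {n} → Matrix n
  identity i j with i ≟ j
  ... | yes _ = 1#
  ... | no  _ = 0#

  diag : ∀ {n} → (Fin n → Carrier) → Matrix n
  diag v i j = v i * identity i j

  scale : ∀ {n} → Carrier → Matrix n → Matrix n
  scale a M i j = a * M i j

  _⊖_ : ∀ {n} → Matrix n → Matrix n → Matrix n
  (M ⊖ N) i j = M i j - N i j

  _⊛_ : ∀ {n} → Matrix n → Matrix n → Matrix n
  (M ⊛ N) i j = sumF (λ l → M i l * N l j)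

  δ₋ : ∀ {n} → (Fin n → Carrier) → Matrix n
  δ₋ xs i j = xs i - xs j

-- Over any commutative ring, x·I − Z·δ₋(X) = x·I + A with A_ij = z_i (x_j − x_i), i.e.
-- A = α·1ᵀ + z·Xᵀ where α_i = −z_i x_i, a matrix of rank at most two.  For such A all principal
-- minors of size ≥ 3 vanish, so det(x·I + A) = xⁿ + tr(A)·xⁿ⁻¹ + e₂(A)·xⁿ⁻² with e₂ the sum of
-- the principal 2×2 minors; here tr A = 0 and the (i,j) minor is z_i z_j (x_i − x_j)².
--
-- The rank-two formula is proved by Laplace expansion along the first row: by linearity in that
-- row the determinant splits into x times a determinant of the same shape and size n − 1, plus
-- two determinants whose first row is u or w.  In those, subtracting multiples of the first row
-- removes the rank-one part along that vector, leaving a bordered matrix handled by a second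
-- induction.  Row operations rest on the alternating property for the first two rows, obtained by
-- expanding along both rows and pairing each term with the one in which the two columns are
-- exchanged.

module Submission where

open import Defs
open import Data.Nat using (ℕ; _≤_; _∸_)
open import Data.Fin using (Fin)
open import Algebra.Bundles using (CommutativeRing)

open import Level using (0ℓ)
open import Algebra.Bundles using (RawRing)
open import Algebra.Solver.Ring.AlmostCommutativeRing using (fromCommutativeRing; _-Raw-AlmostCommutative⟶_)
open import Data.Nat as ℕ using (zero; suc)
import Data.Nat.Properties as ℕ
open import Data.Fin using (zero; suc; punchIn; pinch)
import Data.Fin as Fin
open import Data.Vec.Functional using (Vector; _∷_; tail)
open import Data.Product as Product using (_,_)
open import Data.Maybe using (Maybe; just; nothing)
open import Data.Empty using (⊥-elim)
open import Function using (_∘_)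
open import Relation.Nullary using (yes; no)
open import Relation.Binary.PropositionalEquality as ≡ using (_≡_; _≢_)
import Relation.Binary.Reasoning.Setoid as SetoidReasoning

-- Integer coefficients for Algebra.Solver.Ring, as formal differences (a , b) ↦ a − b: unlike
-- those of R itself, their equality is decidable, which lets the solver cancel terms.
ℕ² : Set
ℕ² = ℕ Product.× ℕ

ℤ-differences : RawRing 0ℓ 0ℓ
ℤ-differences = record
  { Carrier = ℕ²
  ; _≈_     = _≡_
  ; _+_     = λ { (a , b) (c , d) → a ℕ.+ c , b ℕ.+ d }
  ; _*_     = λ { (a , b) (c , d) → a ℕ.* c ℕ.+ b ℕ.* d , a ℕ.* d ℕ.+ b ℕ.* c }
  ; -_      = λ { (a , b) → b , a }
  ; 0#      = 0 , 0
  ; 1#      = 1 , 0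
  }

module IntegerCoefficientSolver {c ℓ} (R : CommutativeRing c ℓ) where
  open CommutativeRing R
  open import Algebra.Properties.Ring ring
  open import Algebra.Properties.CommutativeSemigroup +-commutativeSemigroup using (interchange)
  open import Algebra.Properties.Semiring.Mult.TCOptimised semiring using (_×_; ×-homo-+; ×1-homo-*)
  open import Relation.Binary.Reasoning.Setoid setoid

  [a+c]-[b+d]≈[a-b]+[c-d] : ∀ a b c d → (a + c) - (b + d) ≈ (a - b) + (c - d)
  [a+c]-[b+d]≈[a-b]+[c-d] a b c d = trans (+-congˡ (sym (-‿+-comm b d))) (interchange a c (- b) (- d))

  [a-b][c-d]≈[ac+bd]-[ad+bc] : ∀ a b c d → (a - b) * (c - d) ≈ (a * c + b * d) - (a * d + b * c)
  [a-b][c-d]≈[ac+bd]-[ad+bc] a b c d = begin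
    (a - b) * (c - d)                   ≈⟨ [y-z]x≈yx-zx (c - d) a b ⟩
    a * (c - d) - b * (c - d)           ≈⟨ +-cong (x[y-z]≈xy-xz a c d) (-‿cong (x[y-z]≈xy-xz b c d)) ⟩
    (a * c - a * d) - (b * c - b * d)   ≈⟨ +-congˡ (⁻¹-anti-homo‿- (b * c) (b * d)) ⟩
    (a * c - a * d) + (b * d - b * c)   ≈⟨ [a+c]-[b+d]≈[a-b]+[c-d] (a * c) (a * d) (b * d) (b * c) ⟨
    (a * c + b * d) - (a * d + b * c)   ∎

  -- Special-cased so that the solver's constants 0 and 1 evaluate to 0# and 1# definitionally.
  ⟦_⟧ᶻ : ℕ² → Carrier
  ⟦ a , zero ⟧ᶻ = a × 1#
  ⟦ a , b    ⟧ᶻ = a × 1# - b × 1#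

  ⟦⟧ᶻ-difference : ∀ a b → ⟦ a , b ⟧ᶻ ≈ a × 1# - b × 1#
  ⟦⟧ᶻ-difference a zero    = sym (trans (+-congˡ -0#≈0#) (+-identityʳ _))
  ⟦⟧ᶻ-difference a (suc b) = refl

  ⟦⟧ᶻ-homo-+ : ∀ a b c d → ⟦ a ℕ.+ c , b ℕ.+ d ⟧ᶻ ≈ ⟦ a , b ⟧ᶻ + ⟦ c , d ⟧ᶻ
  ⟦⟧ᶻ-homo-+ a b c d = begin
    ⟦ a ℕ.+ c , b ℕ.+ d ⟧ᶻ                   ≈⟨ ⟦⟧ᶻ-difference (a ℕ.+ c) (b ℕ.+ d) ⟩
    (a ℕ.+ c) × 1# - (b ℕ.+ d) × 1#          ≈⟨ +-cong (×-homo-+ 1# a c) (-‿cong (×-homo-+ 1# b d)) ⟩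
    (a × 1# + c × 1#) - (b × 1# + d × 1#)    ≈⟨ [a+c]-[b+d]≈[a-b]+[c-d] _ _ _ _ ⟩
    (a × 1# - b × 1#) + (c × 1# - d × 1#)    ≈⟨ +-cong (⟦⟧ᶻ-difference a b) (⟦⟧ᶻ-difference c d) ⟨
    ⟦ a , b ⟧ᶻ + ⟦ c , d ⟧ᶻ                  ∎

  ⟦⟧ᶻ-homo-* : ∀ a b c d → ⟦ a ℕ.* c ℕ.+ b ℕ.* d , a ℕ.* d ℕ.+ b ℕ.* c ⟧ᶻ ≈ ⟦ a , b ⟧ᶻ * ⟦ c , d ⟧ᶻ
  ⟦⟧ᶻ-homo-* a b c d = begin
    ⟦ a ℕ.* c ℕ.+ b ℕ.* d , a ℕ.* d ℕ.+ b ℕ.* c ⟧ᶻ  ≈⟨ ⟦⟧ᶻ-difference (a ℕ.* c ℕ.+ b ℕ.* d) (a ℕ.* d ℕ.+ b ℕ.* c) ⟩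
    (a ℕ.* c ℕ.+ b ℕ.* d) × 1# - (a ℕ.* d ℕ.+ b ℕ.* c) × 1#
      ≈⟨ +-cong (×-homo-+-* a c b d) (-‿cong (×-homo-+-* a d b c)) ⟩
    (A * C + B * D) - (A * D + B * C)               ≈⟨ [a-b][c-d]≈[ac+bd]-[ad+bc] A B C D ⟨
    (A - B) * (C - D)                               ≈⟨ *-cong (⟦⟧ᶻ-difference a b) (⟦⟧ᶻ-difference c d) ⟨
    ⟦ a , b ⟧ᶻ * ⟦ c , d ⟧ᶻ                         ∎
    where
    A = a × 1#; B = b × 1#; C = c × 1#; D = d × 1#
    ×-homo-+-* : ∀ a c b d → (a ℕ.* c ℕ.+ b ℕ.* d) × 1# ≈ (a × 1#) * (c × 1#) + (b × 1#) * (d × 1#)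
    ×-homo-+-* a c b d = trans (×-homo-+ 1# (a ℕ.* c) (b ℕ.* d)) (+-cong (×1-homo-* a c) (×1-homo-* b d))

  ⟦⟧ᶻ-homo-- : ∀ a b → ⟦ b , a ⟧ᶻ ≈ - ⟦ a , b ⟧ᶻ
  ⟦⟧ᶻ-homo-- a b = begin
    ⟦ b , a ⟧ᶻ         ≈⟨ ⟦⟧ᶻ-difference b a ⟩
    b × 1# - a × 1#    ≈⟨ ⁻¹-anti-homo‿- (a × 1#) (b × 1#) ⟨
    - (a × 1# - b × 1#) ≈⟨ -‿cong (⟦⟧ᶻ-difference a b) ⟨
    - ⟦ a , b ⟧ᶻ       ∎

  embedding : ℤ-differences -Raw-AlmostCommutative⟶ fromCommutativeRing R
  embedding = record
    { ⟦_⟧    = ⟦_⟧ᶻ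
    ; +-homo = λ { (a , b) (c , d) → ⟦⟧ᶻ-homo-+ a b c d }
    ; *-homo = λ { (a , b) (c , d) → ⟦⟧ᶻ-homo-* a b c d }
    ; -‿homo = λ { (a , b) → ⟦⟧ᶻ-homo-- a b }
    ; 0-homo = refl
    ; 1-homo = refl
    }

  _≟ᶻ_ : ∀ p q → Maybe (⟦ p ⟧ᶻ ≈ ⟦ q ⟧ᶻ)
  (a , b) ≟ᶻ (c , d) with a ℕ.+ d ℕ.≟ c ℕ.+ b
  ... | no  _  = nothing
  ... | yes eq = just (x∙y⁻¹≈ε⇒x≈y _ _ (begin
    ⟦ a , b ⟧ᶻ - ⟦ c , d ⟧ᶻ   ≈⟨ +-congˡ (⟦⟧ᶻ-homo-- c d) ⟨
    ⟦ a , b ⟧ᶻ + ⟦ d , c ⟧ᶻ   ≈⟨ ⟦⟧ᶻ-homo-+ a b d c ⟨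
    ⟦ a ℕ.+ d , b ℕ.+ c ⟧ᶻ   ≡⟨ ≡.cong₂ (λ m n → ⟦ m , n ⟧ᶻ) eq (ℕ.+-comm b c) ⟩
    ⟦ c ℕ.+ b , c ℕ.+ b ⟧ᶻ   ≈⟨ ⟦⟧ᶻ-difference (c ℕ.+ b) (c ℕ.+ b) ⟩
    _ - _                   ≈⟨ -‿inverseʳ _ ⟩
    0#                      ∎))

  open import Algebra.Solver.Ring ℤ-differences (fromCommutativeRing R) embedding _≟ᶻ_ public


module Determinant {c ℓ} (R : CommutativeRing c ℓ) where
  open CommutativeRing R hiding (zero)
  open MatrixDefs R
  open import Algebra.Properties.Ring ring using (-‿involutive; -0#≈0#; -‿+-comm)
  open import Algebra.Properties.CommutativeSemigroup +-commutativeSemigroup using (interchange)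
  open IntegerCoefficientSolver R using (solve; _:+_; _:*_; :-_; _:-_; _:=_; con)
  open import Relation.Binary.Reasoning.Setoid setoid

  sumF-cong : ∀ {n} {f g : Fin n → Carrier} → (∀ i → f i ≈ g i) → sumF f ≈ sumF g
  sumF-cong {zero}  f≈g = refl
  sumF-cong {suc n} f≈g = +-cong (f≈g zero) (sumF-cong (λ i → f≈g (suc i)))

  sumF-zero : ∀ {n} {f : Fin n → Carrier} → (∀ i → f i ≈ 0#) → sumF f ≈ 0#
  sumF-zero {zero}  f≈0 = refl
  sumF-zero {suc n} f≈0 = trans (+-cong (f≈0 zero) (sumF-zero (λ i → f≈0 (suc i)))) (+-identityʳ 0#)

  sumF-homo-+ : ∀ {n} (f g : Fin n → Carrier) → sumF (λ i → f i + g i) ≈ sumF f + sumF g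
  sumF-homo-+ {zero}  f g = sym (+-identityʳ 0#)
  sumF-homo-+ {suc n} f g =
    trans (+-congˡ (sumF-homo-+ (λ i → f (suc i)) (λ i → g (suc i)))) (interchange _ _ _ _)

  sumF-homo-- : ∀ {n} (f : Fin n → Carrier) → sumF (λ i → - f i) ≈ - sumF f
  sumF-homo-- {zero}  f = sym -0#≈0#
  sumF-homo-- {suc n} f = trans (+-congˡ (sumF-homo-- (λ i → f (suc i)))) (-‿+-comm _ _)

  *-distribˡ-sumF : ∀ {n} a (f : Fin n → Carrier) → a * sumF f ≈ sumF (λ i → a * f i)
  *-distribˡ-sumF {zero}  a f = zeroʳ a
  *-distribˡ-sumF {suc n} a f = trans (distribˡ _ _ _) (+-congˡ (*-distribˡ-sumF a (λ i → f (suc i))))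

  sumPairs-cong : ∀ {n} {f g : Fin n → Fin n → Carrier} → (∀ i j → f i j ≈ g i j) → sumPairs f ≈ sumPairs g
  sumPairs-cong {zero}  f≈g = refl
  sumPairs-cong {suc n} f≈g =
    +-cong (sumF-cong (λ j → f≈g zero (suc j))) (sumPairs-cong (λ i j → f≈g (suc i) (suc j)))

  Row : ℕ → Set c
  Row n = Vector Carrier n

  Rows : ℕ → ℕ → Set c
  Rows m n = Vector (Row n) m

  deleteColumn : ∀ {m n} → Fin (suc n) → Rows m (suc n) → Rows m n
  deleteColumn j N r k = N r (punchIn j k)

  det-cong : ∀ {n} {M N : Matrix n} → (∀ i j → M i j ≈ N i j) → det M ≈ det N
  det-cong {zero}  M≈N = refl
  det-cong {suc n} M≈N =
    sumF-cong (λ j → *-congˡ {sgn j} (*-cong (M≈N zero j) (det-cong (λ r k → M≈N (suc r) (punchIn j k)))))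

  -- det (ρ ∷ N) unfolds definitionally to sumF (laplaceTerm ρ N).
  laplaceTerm : ∀ {n} → Row (suc n) → Rows n (suc n) → Fin (suc n) → Carrier
  laplaceTerm ρ N j = sgn j * (ρ j * det (deleteColumn j N))

  det-firstRow-+ : ∀ {n} (ρ σ : Row (suc n)) (N : Rows n (suc n)) →
    det ((λ j → ρ j + σ j) ∷ N) ≈ det (ρ ∷ N) + det (σ ∷ N)
  det-firstRow-+ ρ σ N =
    trans (sumF-cong (λ j → expand (sgn j) (ρ j) (σ j) (det (deleteColumn j N))))
          (sumF-homo-+ (laplaceTerm ρ N) (laplaceTerm σ N))
    where
    expand : ∀ s a b d → s * ((a + b) * d) ≈ s * (a * d) + s * (b * d)
    expand = solve 4 (λ s a b d → s :* ((a :+ b) :* d) := s :* (a :* d) :+ s :* (b :* d)) refl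

  det-firstRow-* : ∀ {n} a (ρ : Row (suc n)) (N : Rows n (suc n)) →
    det ((λ j → a * ρ j) ∷ N) ≈ a * det (ρ ∷ N)
  det-firstRow-* a ρ N =
    trans (sumF-cong (λ j → pull a (sgn j) (ρ j) (det (deleteColumn j N))))
          (sym (*-distribˡ-sumF a (laplaceTerm ρ N)))
    where
    pull : ∀ a s r d → s * ((a * r) * d) ≈ a * (s * (r * d))
    pull = solve 4 (λ a s r d → s :* ((a :* r) :* d) := a :* (s :* (r :* d))) refl

  det-minors-cong : ∀ {n} (ρ : Row (suc n)) {M N : Rows n (suc n)} →
    (∀ j → det (deleteColumn j M) ≈ det (deleteColumn j N)) → det (ρ ∷ M) ≈ det (ρ ∷ N)
  det-minors-cong ρ M≈N = sumF-cong (λ j → *-congˡ {sgn j} (*-congˡ {ρ j} (M≈N j)))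

  det-zeroRow : ∀ {n} (M : Matrix n) (s : Fin n) → (∀ k → M s k ≈ 0#) → det M ≈ 0#
  det-zeroRow {suc n} M zero Ms≈0 =
    sumF-zero (λ j → trans (*-congˡ {sgn j} (trans (*-congʳ (Ms≈0 j)) (zeroˡ (det (minor M j))))) (zeroʳ (sgn j)))
  det-zeroRow {suc n} M (suc s) Ms≈0 =
    sumF-zero (λ j → trans (*-congˡ {sgn j} (trans (*-congˡ {M zero j}
      (det-zeroRow (minor M j) s (λ k → Ms≈0 (punchIn j k)))) (zeroʳ _))) (zeroʳ (sgn j)))

  laplaceTerm-zeroRow : ∀ {n} (ρ : Row (suc n)) (N : Rows n (suc n)) j s →
    (∀ k → deleteColumn j N s k ≈ 0#) → laplaceTerm ρ N j ≈ 0#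
  laplaceTerm-zeroRow ρ N j s row≈0 =
    trans (*-congˡ (trans (*-congˡ (det-zeroRow (deleteColumn j N) s row≈0)) (zeroʳ (ρ j)))) (zeroʳ (sgn j))

  δ : ∀ {n} → Fin n → Fin n → Carrier
  δ zero    zero    = 1#
  δ zero    (suc j) = 0#
  δ (suc i) zero    = 0#
  δ (suc i) (suc j) = δ i j

  identity≈δ : ∀ {n} (i j : Fin n) → identity i j ≈ δ i j
  identity≈δ i j with i Fin.≟ j
  ... | yes ≡.refl = reflexive (≡.sym (δ-refl i))
    where
    δ-refl : ∀ {n} (i : Fin n) → δ i i ≡ 1#
    δ-refl zero    = ≡.refl
    δ-refl (suc i) = δ-refl i
  ... | no  i≢j   = reflexive (≡.sym (δ-≢ i j i≢j))
    where
    δ-≢ : ∀ {n} (i j : Fin n) → i ≢ j → δ i j ≡ 0#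
    δ-≢ zero    zero    i≢j = ⊥-elim (i≢j ≡.refl)
    δ-≢ zero    (suc j) _   = ≡.refl
    δ-≢ (suc i) zero    _   = ≡.refl
    δ-≢ (suc i) (suc j) i≢j = δ-≢ i j (i≢j ∘ ≡.cong suc)

  δ-punchIn : ∀ {n} (i : Fin (suc n)) k → δ i (punchIn i k) ≡ 0#
  δ-punchIn zero    k       = ≡.refl
  δ-punchIn (suc i) zero    = ≡.refl
  δ-punchIn (suc i) (suc k) = δ-punchIn i k

  sumF-δ : ∀ {n} (i : Fin n) (g : Fin n → Carrier) → sumF (λ j → δ i j * g j) ≈ g i
  sumF-δ zero    g = trans (+-cong (*-identityˡ _) (sumF-zero (λ j → zeroˡ (g (suc j))))) (+-identityʳ _)
  sumF-δ (suc i) g = trans (+-cong (zeroˡ _) (sumF-δ i (λ j → g (suc j)))) (+-identityˡ _)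

  det-firstRow-δ : ∀ {n} (i : Fin (suc n)) (N : Rows n (suc n)) →
    det (δ i ∷ N) ≈ sgn i * det (deleteColumn i N)
  det-firstRow-δ i N =
    trans (sumF-cong (λ j → swap (sgn j) (δ i j) (det (deleteColumn j N))))
          (sumF-δ i (λ j → sgn j * det (deleteColumn j N)))
    where
    swap : ∀ s d e → s * (d * e) ≈ d * (s * e)
    swap = solve 3 (λ s d e → s :* (d :* e) := d :* (s :* e)) refl

  doubleSum : ∀ {n} → (Fin (suc n) → Fin n → Carrier) → Carrier
  doubleSum h = sumF (λ j → sumF (h j))

  doubleSum-cong : ∀ {n} {g h : Fin (suc n) → Fin n → Carrier} →
    (∀ j l → g j l ≈ h j l) → doubleSum g ≈ doubleSum h
  doubleSum-cong g≈h = sumF-cong (λ j → sumF-cong (g≈h j))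

  doubleSum-homo-- : ∀ {n} (h : Fin (suc n) → Fin n → Carrier) →
    doubleSum (λ j l → - h j l) ≈ - doubleSum h
  doubleSum-homo-- h = trans (sumF-cong (λ j → sumF-homo-- (h j))) (sumF-homo-- (λ j → sumF (h j)))

  -- A pair (j , l) indexes the ordered pair of distinct positions (j , punchIn j l);
  -- (punchIn j l , pinch l j) indexes the reversed pair.
  punchIn-punchIn-pinch : ∀ {n} (j : Fin (suc n)) l → punchIn (punchIn j l) (pinch l j) ≡ j
  punchIn-punchIn-pinch {suc n} zero l  = ≡.refl
  punchIn-punchIn-pinch (suc j) zero    = ≡.refl
  punchIn-punchIn-pinch (suc j) (suc l) = ≡.cong suc (punchIn-punchIn-pinch j l)

  punchIn-punchIn-reversed : ∀ {n} (j : Fin (suc (suc n))) l c →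
    punchIn j (punchIn l c) ≡ punchIn (punchIn j l) (punchIn (pinch l j) c)
  punchIn-punchIn-reversed zero    l       c       = ≡.refl
  punchIn-punchIn-reversed (suc j) zero    c       = ≡.refl
  punchIn-punchIn-reversed (suc j) (suc l) zero    = ≡.refl
  punchIn-punchIn-reversed (suc j) (suc l) (suc c) = ≡.cong suc (punchIn-punchIn-reversed j l c)

  sgn-reversed : ∀ {n} (j : Fin (suc n)) l → sgn j * sgn l ≈ - (sgn (punchIn j l) * sgn (pinch l j))
  sgn-reversed {suc n} zero l  = solve 1 (λ s → con (1 , 0) :* s := :- ((:- s) :* con (1 , 0))) refl (sgn l)
  sgn-reversed (suc j) zero    = solve 1 (λ s → (:- s) :* con (1 , 0) := :- (con (1 , 0) :* s)) refl (sgn j)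
  sgn-reversed (suc j) (suc l) = begin
    - sgn j * - sgn l                            ≈⟨ solve 2 (λ s t → (:- s) :* (:- t) := s :* t) refl (sgn j) (sgn l) ⟩
    sgn j * sgn l                                ≈⟨ sgn-reversed j l ⟩
    - (sgn (punchIn j l) * sgn (pinch l j))      ≈⟨ solve 2 (λ s t → :- (s :* t) := :- ((:- s) :* (:- t))) refl (sgn (punchIn j l)) (sgn (pinch l j)) ⟩
    - (- sgn (punchIn j l) * - sgn (pinch l j))  ∎

  doubleSum-antisymmetric : ∀ {n} (h : Fin (suc n) → Fin n → Carrier) →
    (∀ j l → h j l ≈ - h (punchIn j l) (pinch l j)) → doubleSum h ≈ 0#
  doubleSum-antisymmetric {zero}  h h-anti = +-identityʳ 0#
  doubleSum-antisymmetric {suc n} h h-anti = begin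
    sumF (h zero) + sumF (λ j → h (suc j) zero + sumF (λ l → h (suc j) (suc l)))
      ≈⟨ +-congˡ (sumF-homo-+ (λ j → h (suc j) zero) (λ j → sumF (λ l → h (suc j) (suc l)))) ⟩
    sumF (h zero) + (sumF (λ j → h (suc j) zero) + doubleSum (λ j l → h (suc j) (suc l)))
      ≈⟨ +-congˡ (+-congˡ (doubleSum-antisymmetric (λ j l → h (suc j) (suc l)) (λ j l → h-anti (suc j) (suc l)))) ⟩
    sumF (h zero) + (sumF (λ j → h (suc j) zero) + 0#)
      ≈⟨ +-cong (trans (sumF-cong (h-anti zero)) (sumF-homo-- (λ l → h (suc l) zero))) (+-identityʳ _) ⟩
    - sumF (λ j → h (suc j) zero) + sumF (λ j → h (suc j) zero)
      ≈⟨ -‿inverseˡ _ ⟩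
    0# ∎

  doubleSum-reversed : ∀ {n} (h : Fin (suc n) → Fin n → Carrier) →
    doubleSum (λ j l → h (punchIn j l) (pinch l j)) ≈ doubleSum h
  doubleSum-reversed {zero}  h = refl
  doubleSum-reversed {suc n} h = begin
    sumF (λ l → h (suc l) zero) + sumF (λ j → h zero j + sumF (λ l → h (suc (punchIn j l)) (suc (pinch l j))))
      ≈⟨ +-congˡ (sumF-homo-+ (h zero) (λ j → sumF (λ l → h (suc (punchIn j l)) (suc (pinch l j))))) ⟩
    sumF (λ l → h (suc l) zero) + (sumF (h zero) + doubleSum (λ j l → h (suc (punchIn j l)) (suc (pinch l j))))
      ≈⟨ +-congˡ (+-congˡ (doubleSum-reversed (λ j l → h (suc j) (suc l)))) ⟩
    sumF (λ l → h (suc l) zero) + (sumF (h zero) + doubleSum (λ j l → h (suc j) (suc l)))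
      ≈⟨ solve 3 (λ a b c → b :+ (a :+ c) := a :+ (b :+ c)) refl _ _ _ ⟩
    sumF (h zero) + (sumF (λ l → h (suc l) zero) + doubleSum (λ j l → h (suc j) (suc l)))
      ≈⟨ +-congˡ (sumF-homo-+ (λ j → h (suc j) zero) (λ j → sumF (λ l → h (suc j) (suc l)))) ⟨
    doubleSum h ∎

  laplaceTerm₂ : ∀ {n} (a b : Row (suc (suc n))) → Rows n (suc (suc n)) →
    Fin (suc (suc n)) → Fin (suc n) → Carrier
  laplaceTerm₂ a b N j l = sgn j * (a j * laplaceTerm (λ k → b (punchIn j k)) (deleteColumn j N) l)

  det-laplace₂ : ∀ {n} (a b : Row (suc (suc n))) (N : Rows n (suc (suc n))) →
    det (a ∷ b ∷ N) ≈ doubleSum (laplaceTerm₂ a b N)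
  det-laplace₂ a b N = sumF-cong (λ j →
    trans (*-congˡ {sgn j} (*-distribˡ-sumF (a j) (laplaceTerm (λ k → b (punchIn j k)) (deleteColumn j N))))
          (*-distribˡ-sumF (sgn j) (λ l → a j * laplaceTerm (λ k → b (punchIn j k)) (deleteColumn j N) l)))

  laplaceTerm₂-reversed : ∀ {n} (a b : Row (suc (suc n))) (N : Rows n (suc (suc n))) j l →
    laplaceTerm₂ b a N j l ≈ - laplaceTerm₂ a b N (punchIn j l) (pinch l j)
  laplaceTerm₂-reversed a b N j l = begin
    sgn j * (b j * (sgn l * (a j′ * D)))          ≈⟨ regroup (sgn j) (sgn l) (b j) (a j′) D ⟩
    (sgn j * sgn l) * (a j′ * b j * D)            ≈⟨ *-congʳ (sgn-reversed j l) ⟩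
    - (sgn j′ * sgn l′) * (a j′ * b j * D)        ≈⟨ regroup⁻ (sgn j′) (sgn l′) (a j′) (b j) D ⟩
    - (sgn j′ * (a j′ * (sgn l′ * (b j * D))))    ≈⟨ -‿cong (*-congˡ (*-congˡ (*-congˡ (*-cong b≈ D≈)))) ⟩
    - laplaceTerm₂ a b N j′ l′                    ∎
    where
    j′ = punchIn j l
    l′ = pinch l j
    D  = det (deleteColumn l (deleteColumn j N))
    b≈ : b j ≈ b (punchIn j′ l′)
    b≈ = reflexive (≡.cong b (≡.sym (punchIn-punchIn-pinch j l)))
    D≈ : D ≈ det (deleteColumn l′ (deleteColumn j′ N))
    D≈ = det-cong (λ r c → reflexive (≡.cong (N r) (punchIn-punchIn-reversed j l c)))
    regroup : ∀ s t a b d → s * (a * (t * (b * d))) ≈ (s * t) * (b * a * d)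
    regroup = solve 5 (λ s t a b d → s :* (a :* (t :* (b :* d))) := (s :* t) :* (b :* a :* d)) refl
    regroup⁻ : ∀ s t a b d → - (s * t) * (a * b * d) ≈ - (s * (a * (t * (b * d))))
    regroup⁻ = solve 5 (λ s t a b d → (:- (s :* t)) :* (a :* b :* d) := :- (s :* (a :* (t :* (b :* d))))) refl

  det-swap₀₁ : ∀ {n} (a b : Row (suc (suc n))) (N : Rows n (suc (suc n))) →
    det (b ∷ a ∷ N) ≈ - det (a ∷ b ∷ N)
  det-swap₀₁ a b N = begin
    det (b ∷ a ∷ N)                                                   ≈⟨ det-laplace₂ b a N ⟩
    doubleSum (laplaceTerm₂ b a N)                                      ≈⟨ doubleSum-cong (laplaceTerm₂-reversed a b N) ⟩
    doubleSum (λ j l → - laplaceTerm₂ a b N (punchIn j l) (pinch l j))  ≈⟨ doubleSum-homo-- (λ j l → laplaceTerm₂ a b N (punchIn j l) (pinch l j)) ⟩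
    - doubleSum (λ j l → laplaceTerm₂ a b N (punchIn j l) (pinch l j))  ≈⟨ -‿cong (doubleSum-reversed (laplaceTerm₂ a b N)) ⟩
    - doubleSum (laplaceTerm₂ a b N)                                    ≈⟨ -‿cong (det-laplace₂ a b N) ⟨
    - det (a ∷ b ∷ N)                                                 ∎

  det-repeatedRow₀₁ : ∀ {n} (a : Row (suc (suc n))) (N : Rows n (suc (suc n))) → det (a ∷ a ∷ N) ≈ 0#
  det-repeatedRow₀₁ a N =
    trans (det-laplace₂ a a N) (doubleSum-antisymmetric (laplaceTerm₂ a a N) (laplaceTerm₂-reversed a a N))

  -- Move row 1 to the top, drop its multiple of ρ by the repeated-row lemma, recurse into the
  -- minors along that row (each of which again has a first row coming from ρ), and swap back.
  det-addMultiplesOfFirstRow : ∀ {n} (ρ : Row (suc n)) (N : Rows n (suc n)) (c : Fin n → Carrier) →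
    det (ρ ∷ (λ r k → N r k + c r * ρ k)) ≈ det (ρ ∷ N)
  det-addMultiplesOfFirstRow {zero}  ρ N c = refl
  det-addMultiplesOfFirstRow {suc n} ρ N c = begin
    det (ρ ∷ N′ zero ∷ tail N′)                  ≈⟨ det-swap₀₁ (N′ zero) ρ (tail N′) ⟩
    - det (N′ zero ∷ ρ ∷ tail N′)                ≈⟨ -‿cong (det-firstRow-+ (N zero) (λ k → c zero * ρ k) (ρ ∷ tail N′)) ⟩
    - (det (N zero ∷ ρ ∷ tail N′) + det ((λ k → c zero * ρ k) ∷ ρ ∷ tail N′))
                                                   ≈⟨ -‿cong (+-congˡ repeated) ⟩
    - (det (N zero ∷ ρ ∷ tail N′) + 0#)          ≈⟨ -‿cong (+-identityʳ _) ⟩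
    - det (N zero ∷ ρ ∷ tail N′)                 ≈⟨ -‿cong (det-minors-cong (N zero) {ρ ∷ tail N′} {ρ ∷ tail N} minors) ⟩
    - det (N zero ∷ ρ ∷ tail N)                  ≈⟨ -‿cong (det-swap₀₁ ρ (N zero) (tail N)) ⟩
    - - det (ρ ∷ N zero ∷ tail N)                ≈⟨ -‿involutive _ ⟩
    det (ρ ∷ N zero ∷ tail N)                    ∎
    where
    N′ : Rows (suc n) (suc (suc n))
    N′ r k = N r k + c r * ρ k
    repeated : det ((λ k → c zero * ρ k) ∷ ρ ∷ tail N′) ≈ 0#
    repeated = trans (det-firstRow-* (c zero) ρ (ρ ∷ tail N′)) (trans (*-congˡ (det-repeatedRow₀₁ ρ (tail N′))) (zeroʳ _))
    minors : ∀ j → det (deleteColumn j (ρ ∷ tail N′)) ≈ det (deleteColumn j (ρ ∷ tail N))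
    minors j = det-addMultiplesOfFirstRow (λ k → ρ (punchIn j k)) (deleteColumn j (tail N)) (tail c)

  δ-punchIn₁ : ∀ {n} (r : Fin n) (k : Fin (suc n)) → δ (suc (suc r)) (punchIn (suc zero) k) ≡ δ (suc r) k
  δ-punchIn₁ r zero    = ≡.refl
  δ-punchIn₁ r (suc k) = ≡.refl

  rankTwo : ∀ {n} → (α β u w : Row n) → Matrix n
  rankTwo α β u w r k = α r * u k + β r * w k

  trace : ∀ {n} → Matrix n → Carrier
  trace A = sumF (λ r → A r r)

  principalMinors₂ : ∀ {n} → Matrix n → Carrier
  principalMinors₂ A = sumPairs (λ r s → A r r * A s s - A r s * A s r)

  module _ (x : Carrier) where

    xRows : ∀ {n} → Rows n (suc n)
    xRows r k = x * δ (suc r) k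

    xRows-deleteColumn-zeroRow : ∀ {n} (j : Fin n) k → deleteColumn (suc j) xRows j k ≈ 0#
    xRows-deleteColumn-zeroRow j k = trans (*-congˡ (reflexive (δ-punchIn (suc j) k))) (zeroʳ x)

    mutual
      det-scalar : ∀ n → det {n} (λ r k → x * δ r k) ≈ pow x n
      det-scalar zero    = refl
      det-scalar (suc n) = trans (det-xRows n (λ k → x * δ zero k)) (*-congʳ (*-identityʳ x))

      det-xRows : ∀ n (σ : Row (suc n)) → det (σ ∷ xRows) ≈ σ zero * pow x n
      det-xRows n σ = begin
        1# * (σ zero * det (deleteColumn zero (xRows {n}))) + sumF (λ j → laplaceTerm σ xRows (suc j))
          ≈⟨ +-cong (*-identityˡ _) (sumF-zero (λ j → laplaceTerm-zeroRow σ xRows (suc j) j (xRows-deleteColumn-zeroRow j))) ⟩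
        σ zero * det {n} (λ r k → x * δ r k) + 0#     ≈⟨ +-identityʳ _ ⟩
        σ zero * det {n} (λ r k → x * δ r k)          ≈⟨ *-congˡ (det-scalar n) ⟩
        σ zero * pow x n                              ∎

    det-twoRows-xRows : ∀ n (ρ w : Row (suc (suc n))) →
      det (ρ ∷ w ∷ tail xRows) ≈ (ρ zero * w (suc zero) - ρ (suc zero) * w zero) * pow x n
    det-twoRows-xRows n ρ w = begin
      1# * (ρ zero * det (deleteColumn zero (w ∷ tail xRows)))
        + (- 1# * (ρ (suc zero) * det (deleteColumn (suc zero) (w ∷ tail xRows)))
        + sumF (λ j → laplaceTerm ρ (w ∷ tail xRows) (suc (suc j))))
        ≈⟨ +-cong (*-congˡ (*-congˡ (det-xRows n (tail w))))
                  (+-cong (*-congˡ (*-congˡ (trans (det-cong column₁) (det-xRows n (λ k → w (punchIn (suc zero) k))))))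
                          (sumF-zero otherTerms)) ⟩
      1# * (ρ zero * (w (suc zero) * pow x n)) + (- 1# * (ρ (suc zero) * (w zero * pow x n)) + 0#)
        ≈⟨ solve 5 (λ r₀ r₁ w₀ w₁ X → con (1 , 0) :* (r₀ :* (w₁ :* X)) :+ ((:- con (1 , 0)) :* (r₁ :* (w₀ :* X)) :+ con (0 , 0))
                                    := (r₀ :* w₁ :- r₁ :* w₀) :* X) refl _ _ _ _ _ ⟩
      (ρ zero * w (suc zero) - ρ (suc zero) * w zero) * pow x n ∎
      where
      column₁ : ∀ r k → deleteColumn (suc zero) (w ∷ tail xRows) r k ≈ ((λ k → w (punchIn (suc zero) k)) ∷ xRows) r k
      column₁ zero    k = refl
      column₁ (suc r) k = *-congˡ (reflexive (δ-punchIn₁ r k))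
      otherTerms : ∀ j → laplaceTerm ρ (w ∷ tail xRows) (suc (suc j)) ≈ 0#
      otherTerms j = laplaceTerm-zeroRow ρ (w ∷ tail xRows) (suc (suc j)) (suc j) (xRows-deleteColumn-zeroRow (suc j))

    -- For n = 0 the truncated exponents disagree, but then the sum is empty.
    sumF-shiftPow : ∀ n (f : Row n) → sumF f * (x * pow x (n ∸ 1)) ≈ sumF f * pow x n
    sumF-shiftPow zero    f = trans (zeroˡ _) (sym (zeroˡ _))
    sumF-shiftPow (suc n) f = refl

    sumPairs-shiftPow : ∀ n (f : Fin n → Fin n → Carrier) →
      sumPairs f * (x * pow x (n ∸ 2)) ≈ sumPairs f * pow x (n ∸ 1)
    sumPairs-shiftPow zero          f = trans (zeroˡ _) (sym (zeroˡ _))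
    sumPairs-shiftPow (suc zero)    f = trans (*-congʳ (+-identityʳ 0#)) (trans (zeroˡ _)
                                          (sym (trans (*-congʳ (+-identityʳ 0#)) (zeroˡ _))))
    sumPairs-shiftPow (suc (suc n)) f = refl

    rankOneRows : ∀ {n} → Row n → Row (suc n) → Rows n (suc n)
    rankOneRows β w r k = x * δ (suc r) k + β r * w k

    det-rankOneRows : ∀ n (ρ w : Row (suc n)) (β : Row n) →
      det (ρ ∷ rankOneRows β w)
        ≈ pow x n * ρ zero + sumF (λ r → β r * (ρ zero * w (suc r) - ρ (suc r) * w zero)) * pow x (n ∸ 1)
    det-rankOneRows zero ρ w β =
      solve 1 (λ r → con (1 , 0) :* (r :* con (1 , 0)) :+ con (0 , 0) := con (1 , 0) :* r :+ con (0 , 0) :* con (1 , 0))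
        refl (ρ zero)
    det-rankOneRows (suc n) ρ w β = begin
      det (ρ ∷ N zero ∷ tail N)                                      ≈⟨ det-swap₀₁ (N zero) ρ (tail N) ⟩
      - det (N zero ∷ X)                                              ≈⟨ -‿cong (det-firstRow-+ (λ k → x * δ (suc zero) k) (λ k → β zero * w k) X) ⟩
      - (det ((λ k → x * δ (suc zero) k) ∷ X) + det ((λ k → β zero * w k) ∷ X))
        ≈⟨ -‿cong (+-cong (det-firstRow-* x (δ (suc zero)) X) (det-firstRow-* (β zero) w X)) ⟩
      - (x * det (δ (suc zero) ∷ X) + β zero * det (w ∷ X))         ≈⟨ -‿cong (+-cong (*-congˡ unitRow) (*-congˡ wRow)) ⟩
      - (x * (- 1# * (P * ρ zero + S′ * Q)) + β zero * - (D * P))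
        ≈⟨ solve 7 (λ x P Q ρ₀ S′ β₀ D → :- (x :* ((:- con (1 , 0)) :* (P :* ρ₀ :+ S′ :* Q)) :+ β₀ :* (:- (D :* P)))
                                     := x :* P :* ρ₀ :+ (β₀ :* D :* P :+ S′ :* (x :* Q))) refl x P Q (ρ zero) S′ (β zero) D ⟩
      x * P * ρ zero + (β zero * D * P + S′ * (x * Q))                ≈⟨ +-congˡ (+-congˡ (sumF-shiftPow n _)) ⟩
      x * P * ρ zero + (β zero * D * P + S′ * P)                       ≈⟨ +-congˡ (sym (distribʳ P _ _)) ⟩
      x * P * ρ zero + (β zero * D + S′) * P                           ∎
      where
      N = rankOneRows β w
      X = ρ ∷ tail N
      P = pow x n
      Q = pow x (n ∸ 1)
      D = ρ zero * w (suc zero) - ρ (suc zero) * w zero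
      ρ′ w′ : Row (suc n)
      ρ′ k = ρ (punchIn (suc zero) k)
      w′ k = w (punchIn (suc zero) k)
      S′ = sumF (λ r → β (suc r) * (ρ′ zero * w′ (suc r) - ρ′ (suc r) * w′ zero))
      unitRow : det (δ (suc zero) ∷ X) ≈ - 1# * (P * ρ zero + S′ * Q)
      unitRow = trans (det-firstRow-δ (suc zero) X)
                      (*-congˡ (trans (det-cong column₁) (det-rankOneRows n ρ′ w′ (tail β))))
        where
        column₁ : ∀ r k → deleteColumn (suc zero) X r k ≈ (ρ′ ∷ rankOneRows (tail β) w′) r k
        column₁ zero    k = refl
        column₁ (suc r) k = +-congʳ (*-congˡ (reflexive (δ-punchIn₁ r k)))
      wRow : det (w ∷ X) ≈ - (D * P)
      wRow = begin
        det (w ∷ X)                                                  ≈⟨ det-cong rowsOfX ⟩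
        det (w ∷ (λ r k → (ρ ∷ tail xRows) r k + (0# ∷ tail β) r * w k))
                                                                      ≈⟨ det-addMultiplesOfFirstRow w (ρ ∷ tail xRows) (0# ∷ tail β) ⟩
        det (w ∷ ρ ∷ tail xRows)                                    ≈⟨ det-swap₀₁ ρ w (tail xRows) ⟩
        - det (ρ ∷ w ∷ tail xRows)                                  ≈⟨ -‿cong (det-twoRows-xRows n ρ w) ⟩
        - (D * P)                                                     ∎
        where
        rowsOfX : ∀ r k → (w ∷ X) r k ≈ (w ∷ (λ r k → (ρ ∷ tail xRows) r k + (0# ∷ tail β) r * w k)) r k
        rowsOfX zero          k = refl
        rowsOfX (suc zero)    k = sym (trans (+-congˡ (zeroˡ (w k))) (+-identityʳ (ρ k)))
        rowsOfX (suc (suc r)) k = refl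

    det-rankTwoRows : ∀ n (ρ w : Row (suc n)) (α β : Row n) →
      det (ρ ∷ (λ r k → x * δ (suc r) k + (α r * ρ k + β r * w k)))
        ≈ pow x n * ρ zero + sumF (λ r → β r * (ρ zero * w (suc r) - ρ (suc r) * w zero)) * pow x (n ∸ 1)
    det-rankTwoRows n ρ w α β = begin
      det (ρ ∷ (λ r k → x * δ (suc r) k + (α r * ρ k + β r * w k)))  ≈⟨ det-cong rearrange ⟩
      det (ρ ∷ (λ r k → rankOneRows β w r k + α r * ρ k))             ≈⟨ det-addMultiplesOfFirstRow ρ (rankOneRows β w) α ⟩
      det (ρ ∷ rankOneRows β w)                                       ≈⟨ det-rankOneRows n ρ w β ⟩
      _                                                               ∎
      where
      rearrange : ∀ r k → (ρ ∷ (λ r k → x * δ (suc r) k + (α r * ρ k + β r * w k))) r k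
                        ≈ (ρ ∷ (λ r k → rankOneRows β w r k + α r * ρ k)) r k
      rearrange zero    k = refl
      rearrange (suc r) k = solve 5 (λ a b c d e → a :+ (b :* c :+ d :* e) := (a :+ d :* e) :+ b :* c) refl
                              (x * δ (suc r) k) (α r) (ρ k) (β r) (w k)

    det-scalar+rankTwo : ∀ n (α β u w : Row n) →
      det (λ r k → x * δ r k + rankTwo α β u w r k)
        ≈ pow x n + trace (rankTwo α β u w) * pow x (n ∸ 1) + principalMinors₂ (rankTwo α β u w) * pow x (n ∸ 2)
    det-scalar+rankTwo zero α β u w =
      solve 0 (con (1 , 0) := con (1 , 0) :+ con (0 , 0) :* con (1 , 0) :+ con (0 , 0) :* con (1 , 0)) refl
    det-scalar+rankTwo (suc n) α β u w = begin
      det ((λ k → x * δ zero k + (α zero * u k + β zero * w k)) ∷ N)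
        ≈⟨ det-firstRow-+ (λ k → x * δ zero k) (λ k → α zero * u k + β zero * w k) N ⟩
      det ((λ k → x * δ zero k) ∷ N) + det ((λ k → α zero * u k + β zero * w k) ∷ N)
        ≈⟨ +-cong (det-firstRow-* x (δ zero) N)
                  (trans (det-firstRow-+ (λ k → α zero * u k) (λ k → β zero * w k) N)
                         (+-cong (det-firstRow-* (α zero) u N) (det-firstRow-* (β zero) w N))) ⟩
      x * det (δ zero ∷ N) + (α zero * det (u ∷ N) + β zero * det (w ∷ N))
        ≈⟨ +-cong (*-congˡ (trans (det-firstRow-δ zero N) (*-congˡ (det-scalar+rankTwo n (tail α) (tail β) (tail u) (tail w)))))
                  (+-cong (*-congˡ uRow) (*-congˡ wRow)) ⟩
      x * (1# * (P + T′ * Q + E′ * Q₂)) + (α zero * (P * u zero + SU * Q) + β zero * (P * w zero + SW * Q))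
        ≈⟨ solve 12 (λ x P Q Q₂ T′ E′ SU SW α₀ β₀ u₀ w₀ →
             x :* (con (1 , 0) :* (P :+ T′ :* Q :+ E′ :* Q₂)) :+ (α₀ :* (P :* u₀ :+ SU :* Q) :+ β₀ :* (P :* w₀ :+ SW :* Q))
             := x :* P :+ (α₀ :* u₀ :+ β₀ :* w₀) :* P :+ T′ :* (x :* Q) :+ ((α₀ :* SU :+ β₀ :* SW) :* Q :+ E′ :* (x :* Q₂)))
             refl x P Q Q₂ T′ E′ SU SW (α zero) (β zero) (u zero) (w zero) ⟩
      x * P + A₀₀ * P + T′ * (x * Q) + ((α zero * SU + β zero * SW) * Q + E′ * (x * Q₂))
        ≈⟨ +-cong (+-congˡ (sumF-shiftPow n _)) (+-congˡ (sumPairs-shiftPow n _)) ⟩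
      x * P + A₀₀ * P + T′ * P + ((α zero * SU + β zero * SW) * Q + E′ * Q)
        ≈⟨ solve 7 (λ xP a t c e P Q → xP :+ a :* P :+ t :* P :+ (c :* Q :+ e :* Q) := xP :+ (a :+ t) :* P :+ (c :+ e) :* Q)
             refl (x * P) A₀₀ T′ (α zero * SU + β zero * SW) E′ P Q ⟩
      x * P + (A₀₀ + T′) * P + ((α zero * SU + β zero * SW) + E′) * Q
        ≈⟨ +-congˡ (*-congʳ (+-congʳ (sym crossTerms))) ⟩
      x * P + trace A * P + principalMinors₂ A * Q ∎
      where
      A = rankTwo α β u w
      A′ = rankTwo (tail α) (tail β) (tail u) (tail w)
      N : Rows n (suc n)
      N r k = x * δ (suc r) k + A (suc r) k
      A₀₀ = A zero zero
      P = pow x n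
      Q = pow x (n ∸ 1)
      Q₂ = pow x (n ∸ 2)
      T′ = trace A′
      E′ = principalMinors₂ A′
      termU termW : Row n
      termU r = β (suc r) * (u zero * w (suc r) - u (suc r) * w zero)
      termW r = α (suc r) * (w zero * u (suc r) - w (suc r) * u zero)
      SU = sumF termU
      SW = sumF termW
      uRow : det (u ∷ N) ≈ P * u zero + SU * Q
      uRow = det-rankTwoRows n u w (tail α) (tail β)
      wRow : det (w ∷ N) ≈ P * w zero + SW * Q
      wRow = trans (det-cong swapSummands) (det-rankTwoRows n w u (tail β) (tail α))
        where
        swapSummands : ∀ r k → (w ∷ N) r k ≈ (w ∷ (λ r k → x * δ (suc r) k + (β (suc r) * w k + α (suc r) * u k))) r k
        swapSummands zero    k = refl
        swapSummands (suc r) k = +-congˡ (+-comm _ _)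
      crossTerms : sumF (λ j → A₀₀ * A (suc j) (suc j) - A zero (suc j) * A (suc j) zero) ≈ α zero * SU + β zero * SW
      crossTerms = begin
        sumF (λ j → A₀₀ * A (suc j) (suc j) - A zero (suc j) * A (suc j) zero)
          ≈⟨ sumF-cong (λ j → expand (α zero) (β zero) (u zero) (w zero) (α (suc j)) (β (suc j)) (u (suc j)) (w (suc j))) ⟩
        sumF (λ j → α zero * termU j + β zero * termW j)                ≈⟨ sumF-homo-+ (λ j → α zero * termU j) (λ j → β zero * termW j) ⟩
        sumF (λ j → α zero * termU j) + sumF (λ j → β zero * termW j)   ≈⟨ +-cong (*-distribˡ-sumF (α zero) termU) (*-distribˡ-sumF (β zero) termW) ⟨
        α zero * SU + β zero * SW                                       ∎
        where
        expand : ∀ a₀ b₀ u₀ w₀ a b u w →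
          (a₀ * u₀ + b₀ * w₀) * (a * u + b * w) - (a₀ * u + b₀ * w) * (a * u₀ + b * w₀)
            ≈ a₀ * (b * (u₀ * w - u * w₀)) + b₀ * (a * (w₀ * u - w * u₀))
        expand = solve 8 (λ a₀ b₀ u₀ w₀ a b u w →
          (a₀ :* u₀ :+ b₀ :* w₀) :* (a :* u :+ b :* w) :- (a₀ :* u :+ b₀ :* w) :* (a :* u₀ :+ b :* w₀)
          := a₀ :* (b :* (u₀ :* w :- u :* w₀)) :+ b₀ :* (a :* (w₀ :* u :- w :* u₀))) refl

  minusZδ₋ : ∀ {n} → Row n → Row n → Matrix n
  minusZδ₋ xs zs = rankTwo (λ i → - (zs i * xs i)) zs (λ _ → 1#) xs

  xI-Zδ₋≈xδ+minusZδ₋ : ∀ {n} x (xs zs : Row n) r c →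
    (scale x identity ⊖ (diag zs ⊛ δ₋ xs)) r c ≈ x * δ r c + minusZδ₋ xs zs r c
  xI-Zδ₋≈xδ+minusZδ₋ x xs zs r c = begin
    x * identity r c - sumF (λ l → zs r * identity r l * (xs l - xs c))
      ≈⟨ +-cong (*-congˡ (identity≈δ r c)) (-‿cong (trans (sumF-cong selectRow) (sumF-δ r (λ l → zs r * (xs l - xs c))))) ⟩
    x * δ r c - zs r * (xs r - xs c)
      ≈⟨ solve 4 (λ X z a b → X :- z :* (a :- b) := X :+ ((:- (z :* a)) :* con (1 , 0) :+ z :* b))
           refl (x * δ r c) (zs r) (xs r) (xs c) ⟩
    x * δ r c + minusZδ₋ xs zs r c ∎
    where
    selectRow : ∀ l → zs r * identity r l * (xs l - xs c) ≈ δ r l * (zs r * (xs l - xs c))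
    selectRow l = trans (*-congʳ (*-congˡ (identity≈δ r l)))
      (solve 3 (λ z d e → z :* d :* e := d :* (z :* e)) refl (zs r) (δ r l) (xs l - xs c))

  trace-minusZδ₋ : ∀ {n} (xs zs : Row n) → trace (minusZδ₋ xs zs) ≈ 0#
  trace-minusZδ₋ xs zs =
    sumF-zero (λ r → solve 2 (λ z a → (:- (z :* a)) :* con (1 , 0) :+ z :* a := con (0 , 0)) refl (zs r) (xs r))

  principalMinors₂-minusZδ₋ : ∀ {n} (xs zs : Row n) →
    principalMinors₂ (minusZδ₋ xs zs) ≈ sumPairs (λ i j → zs i * zs j * ((xs i - xs j) * (xs i - xs j)))
  principalMinors₂-minusZδ₋ xs zs = sumPairs-cong (λ r s → solve 4 (λ zr zs xr xs →
    ((:- (zr :* xr)) :* con (1 , 0) :+ zr :* xr) :* ((:- (zs :* xs)) :* con (1 , 0) :+ zs :* xs)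
      :- ((:- (zr :* xr)) :* con (1 , 0) :+ zr :* xs) :* ((:- (zs :* xs)) :* con (1 , 0) :+ zs :* xr)
    := zr :* zs :* ((xr :- xs) :* (xr :- xs))) refl (zs r) (zs s) (xs r) (xs s))

-- The formula also holds for k = 0.
lemma3p5 : ∀ {c ℓ} (R : CommutativeRing c ℓ) (k : ℕ) → 1 ≤ k →
    (x : CommutativeRing.Carrier R) (xs zs : Fin k → CommutativeRing.Carrier R) →
    let open CommutativeRing R
        open MatrixDefs R
    in det (scale x identity ⊖ (diag zs ⊛ δ₋ xs))
       ≈ pow x k + sumPairs (λ i j → zs i * zs j * ((xs i - xs j) * (xs i - xs j))) * pow x (k ∸ 2)
lemma3p5 R k _ x xs zs = begin
  det (scale x identity ⊖ (diag zs ⊛ δ₋ xs))          ≈⟨ det-cong (xI-Zδ₋≈xδ+minusZδ₋ x xs zs) ⟩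
  det (λ r c → x * δ r c + A r c)                    ≈⟨ det-scalar+rankTwo x k (λ i → - (zs i * xs i)) zs (λ _ → 1#) xs ⟩
  pow x k + trace A * pow x (k ∸ 1) + principalMinors₂ A * pow x (k ∸ 2)
    ≈⟨ +-cong (+-congˡ (*-congʳ (trace-minusZδ₋ xs zs))) (*-congʳ (principalMinors₂-minusZδ₋ xs zs)) ⟩
  pow x k + 0# * pow x (k ∸ 1) + sumPairs (λ i j → zs i * zs j * ((xs i - xs j) * (xs i - xs j))) * pow x (k ∸ 2)
    ≈⟨ +-congʳ (trans (+-congˡ (zeroˡ _)) (+-identityʳ _)) ⟩
  pow x k + sumPairs (λ i j → zs i * zs j * ((xs i - xs j) * (xs i - xs j))) * pow x (k ∸ 2) ∎
  where
  open CommutativeRing R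
  open MatrixDefs R
  open Determinant R
  open SetoidReasoning setoid
  A = minusZδ₋ xs zs
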